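{- Let $\epsilon$ and $\delta$ be real numbers with $0<\epsilon<\frac{2}{5}$ and $0<\delta\le\frac{1}{30}$, and let $\tau$ be a positive integer. Suppose that $\Gamma$ is a $D$-regular graph on vertex set $[n]$ such that $\|Q^{\tau}_v-U\|<\delta$ for at least $\epsilon n$ vertices $v\in[n]$. Then $\Gamma$ has no separator of size smaller than $\frac{\epsilon}{48\tau}n$.
   Context: All graphs are finite simple graphs; $D\ge 1$. For a $D$-regular graph $\Gamma$ on $[n]$, the random walk moves at each step to a uniformly random neighbor of the current vertex, independently of the history; $Q^t_v$ denotes the distribution of the position after $t$ steps of the walk started at $v$. $U$ is the uniform distribution on $[n]$, and $\|P_1-P_2\|=\max_{A\subseteq[n]}|P_1(A)-P_2(A)|$ is the total variation distance. For an $n$-vertex graph $G$, a vertex set $S\subseteq V(G)$ is a separator if removing $S$ from $G$ leaves a graph each of whose connected components has at most $2n/3$ vertices (equivalently, $V(G)\setminus S$ can be partitioned into parts with no edges between different parts, each part having at most $2n/3$ vertices).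
   Formalization: The parameters ε and δ are rational rather than real numbers. -}

module Defs where

open import Data.Nat as ℕ using (ℕ; zero; suc)
open import Data.Integer using (+_)
open import Data.Rational using (ℚ; 0ℚ; 1ℚ; _+_; _*_; _-_; ∣_∣; _<_; _/_)
open import Data.Bool using (Bool; true; false; if_then_else_)
open import Data.Fin using (Fin; zero; suc)
open import Data.Fin.Subset using (Subset; _∈_; _∉_) renaming (∣_∣ to card)
open import Data.Vec using (lookup)
open import Data.Product using (Σ; _×_; _,_)
open import Relation.Binary.PropositionalEquality using (_≡_)

ℕ→ℚ : ℕ → ℚ
ℕ→ℚ k = + k / 1

-- 1/k as a rational (only used with k ≥ 1; value 0 at k = 0 is a dummy)
recip : ℕ → ℚ
recip zero    = 0ℚ
recip (suc k) = + 1 / suc k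

sumℚ : {n : ℕ} → (Fin n → ℚ) → ℚ
sumℚ {zero}  f = 0ℚ
sumℚ {suc n} f = f zero + sumℚ (λ i → f (suc i))

sumℕ : {n : ℕ} → (Fin n → ℕ) → ℕ
sumℕ {zero}  f = 0
sumℕ {suc n} f = f zero ℕ.+ sumℕ (λ i → f (suc i))

record Graph (n : ℕ) : Set where
  field
    adj    : Fin n → Fin n → Bool
    sym    : ∀ u v → adj u v ≡ adj v u
    irrefl : ∀ v → adj v v ≡ false
open Graph public

b2ℕ : Bool → ℕ
b2ℕ true  = 1
b2ℕ false = 0

degree : {n : ℕ} → Graph n → Fin n → ℕ
degree G v = sumℕ (λ u → b2ℕ (adj G v u))

Regular : {n : ℕ} → ℕ → Graph n → Set
Regular D G = ∀ v → degree G v ≡ D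

δpt : {n : ℕ} → Fin n → Fin n → ℚ
δpt zero    zero    = 1ℚ
δpt zero    (suc _) = 0ℚ
δpt (suc _) zero    = 0ℚ
δpt (suc v) (suc u) = δpt v u

-- Q t v u : probability that the simple random walk on the D-regular graph G,
-- started at v, is at u after t steps (each step: uniform neighbour, prob 1/D)
Q : {n : ℕ} → Graph n → (D : ℕ) → ℕ → Fin n → Fin n → ℚ
Q G D zero    v u = δpt v u
Q G D (suc t) v u =
  sumℚ (λ w → Q G D t v w * (if adj G w u then recip D else 0ℚ))

prob : {n : ℕ} → (Fin n → ℚ) → Subset n → ℚ
prob P A = sumℚ (λ u → if lookup A u then P u else 0ℚ)

uniform : {n : ℕ} → Subset n → ℚ
uniform {n} A = ℕ→ℚ (card A) * recip n

-- ‖P₁ − P₂‖ < δ, where ‖P₁ − P₂‖ = max_A |P₁(A) − P₂(A)|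
-- (the max over the finitely many subsets A is < δ iff every term is < δ)
DevFromUniformLess : {n : ℕ} → (Fin n → ℚ) → Subset n → ℚ → Set
DevFromUniformLess P₁ A δ = ∣ prob P₁ A - uniform A ∣ < δ

TVToUniformLess : {n : ℕ} → (Fin n → ℚ) → ℚ → Set
TVToUniformLess {n} P δ = (A : Subset n) → DevFromUniformLess P A δ

partSize : {n : ℕ} → Subset n → (Fin n → ℕ) → ℕ → ℕ
partSize S f k = sumℕ (λ u → if lookup S u then 0 else (if f u ℕ.≡ᵇ k then 1 else 0))

-- S is a separator: V(G) \ S can be partitioned (via a labelling f of parts) into
-- parts with no edges between different parts, each of size at most 2n/3
IsSeparator : {n : ℕ} → Graph n → Subset n → Set
IsSeparator {n} G S =
  Σ (Fin n → ℕ) λ f →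
    ((u v : Fin n) → u ∉ S → v ∉ S → adj G u v ≡ true → f u ≡ f v)
    × ((k : ℕ) → 3 ℕ.* partSize S f k ℕ.≤ 2 ℕ.* n)

{-# OPTIONS --safe #-}
-- Every walk of length τ from v either avoids S, and then (parts being unions of components of
-- G − S) ends in the part of v, or visits S at some time s ≤ τ.  If more than 23/24 of the D^τ
-- walks from v avoid S, then Q^τ_v gives mass > 23/24 to a part of uniform mass ≤ 2/3, so
-- ‖Q^τ_v − U‖ > 1/30 ≥ δ.  Hence from each well-mixed vertex at least D^τ/24 walks visit S.
-- By regularity each vertex is the time-s position of exactly D^τ of all n·D^τ walks, so the
-- visits to S, summed over all start vertices, number (τ+1)|S|D^τ.  Therefore
-- εn ≤ #{well-mixed vertices} ≤ 24(τ+1)|S| ≤ 48τ|S|.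
module Submission where

module ℕ→ℚ-Properties where

  open import Defs using (ℕ→ℚ; recip; sumℚ)
  open import Data.Nat as ℕ using (ℕ; zero; suc; NonZero)
  import Data.Nat.Properties as ℕₚ
  open import Data.Fin using (Fin; zero; suc)
  open import Data.Integer as ℤ using (+_)
  import Data.Integer.Properties as ℤ
  open import Data.Rational using (ℚ; 1ℚ; _+_; _*_; _≤_; _<_; toℚᵘ; Positive; positive)
  open import Data.Rational.Properties
  import Data.Rational.Unnormalised as ℚᵘ
  import Data.Rational.Unnormalised.Properties as ℚᵘ
  open import Algebra.Properties.Semiring.Sum ℕₚ.+-*-semiring using (sum)
  open import Relation.Binary.PropositionalEquality

  private
    ℕ→ℚᵘ : ℕ → ℚᵘ.ℚᵘ
    ℕ→ℚᵘ k = ℚᵘ.mkℚᵘ (+ k) 0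

    toℚᵘ-ℕ→ℚ : ∀ k → toℚᵘ (ℕ→ℚ k) ℚᵘ.≃ ℕ→ℚᵘ k
    toℚᵘ-ℕ→ℚ k = toℚᵘ-fromℚᵘ (ℕ→ℚᵘ k)

  ℕ→ℚ-homo-+ : ∀ a b → ℕ→ℚ (a ℕ.+ b) ≡ ℕ→ℚ a + ℕ→ℚ b
  ℕ→ℚ-homo-+ a b = toℚᵘ-injective (begin
    toℚᵘ (ℕ→ℚ (a ℕ.+ b))             ≈⟨ toℚᵘ-ℕ→ℚ (a ℕ.+ b) ⟩
    ℕ→ℚᵘ (a ℕ.+ b)                   ≈⟨ ℚᵘ.*≡* (cong (ℤ._* + 1) homo) ⟩
    ℕ→ℚᵘ a ℚᵘ.+ ℕ→ℚᵘ b               ≈⟨ ℚᵘ.+-cong (toℚᵘ-ℕ→ℚ a) (toℚᵘ-ℕ→ℚ b) ⟨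
    toℚᵘ (ℕ→ℚ a) ℚᵘ.+ toℚᵘ (ℕ→ℚ b)   ≈⟨ toℚᵘ-homo-+ (ℕ→ℚ a) (ℕ→ℚ b) ⟨
    toℚᵘ (ℕ→ℚ a + ℕ→ℚ b)             ∎)
    where
    open ℚᵘ.≃-Reasoning
    homo : + (a ℕ.+ b) ≡ + a ℤ.* + 1 ℤ.+ + b ℤ.* + 1
    homo = trans (ℤ.pos-+ a b) (sym (cong₂ ℤ._+_ (ℤ.*-identityʳ (+ a)) (ℤ.*-identityʳ (+ b))))

  ℕ→ℚ-homo-* : ∀ a b → ℕ→ℚ (a ℕ.* b) ≡ ℕ→ℚ a * ℕ→ℚ b
  ℕ→ℚ-homo-* a b = toℚᵘ-injective (begin
    toℚᵘ (ℕ→ℚ (a ℕ.* b))             ≈⟨ toℚᵘ-ℕ→ℚ (a ℕ.* b) ⟩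
    ℕ→ℚᵘ (a ℕ.* b)                   ≈⟨ ℚᵘ.*≡* (cong (ℤ._* + 1) (ℤ.pos-* a b)) ⟩
    ℕ→ℚᵘ a ℚᵘ.* ℕ→ℚᵘ b               ≈⟨ ℚᵘ.*-cong (toℚᵘ-ℕ→ℚ a) (toℚᵘ-ℕ→ℚ b) ⟨
    toℚᵘ (ℕ→ℚ a) ℚᵘ.* toℚᵘ (ℕ→ℚ b)   ≈⟨ toℚᵘ-homo-* (ℕ→ℚ a) (ℕ→ℚ b) ⟨
    toℚᵘ (ℕ→ℚ a * ℕ→ℚ b)             ∎)
    where open ℚᵘ.≃-Reasoning

  ℕ→ℚ-mono-≤ : ∀ {a b} → a ℕ.≤ b → ℕ→ℚ a ≤ ℕ→ℚ b
  ℕ→ℚ-mono-≤ {a} {b} a≤b = toℚᵘ-cancel-≤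
    (ℚᵘ.≤-respˡ-≃ (ℚᵘ.≃-sym (toℚᵘ-ℕ→ℚ a)) (ℚᵘ.≤-respʳ-≃ (ℚᵘ.≃-sym (toℚᵘ-ℕ→ℚ b))
      (ℚᵘ.*≤* (ℤ.*-monoʳ-≤-nonNeg (+ 1) (ℤ.+≤+ a≤b)))))

  ℕ→ℚ-cancel-< : ∀ {a b} → ℕ→ℚ a < ℕ→ℚ b → a ℕ.< b
  ℕ→ℚ-cancel-< {a} {b} a<b
    with ℚᵘ.<-respˡ-≃ (toℚᵘ-ℕ→ℚ a) (ℚᵘ.<-respʳ-≃ (toℚᵘ-ℕ→ℚ b) (toℚᵘ-mono-< a<b))
  ... | ℚᵘ.*<* a<b = ℤ.drop‿+<+ (subst₂ ℤ._<_ (ℤ.*-identityʳ (+ a)) (ℤ.*-identityʳ (+ b)) a<b)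

  ℕ→ℚ-positive : ∀ k .{{_ : NonZero k}} → Positive (ℕ→ℚ k)
  ℕ→ℚ-positive (suc k) = positive (<-≤-trans (positive⁻¹ 1ℚ) (ℕ→ℚ-mono-≤ {1} {suc k} (ℕ.s≤s ℕ.z≤n)))

  recip-inverseˡ : ∀ k .{{_ : NonZero k}} → recip k * ℕ→ℚ k ≡ 1ℚ
  recip-inverseˡ (suc k) = toℚᵘ-injective (ℚᵘ.≃-trans (toℚᵘ-homo-* (recip (suc k)) (ℕ→ℚ (suc k)))
    (ℚᵘ.≃-trans (ℚᵘ.*-cong (toℚᵘ-fromℚᵘ (ℚᵘ.mkℚᵘ (+ 1) k)) (toℚᵘ-ℕ→ℚ (suc k)))
      (ℚᵘ.*-inverseʳ (ℚᵘ.mkℚᵘ (+ 1) k))))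

  sumℚ-cong : ∀ {n} {f g : Fin n → ℚ} → (∀ i → f i ≡ g i) → sumℚ f ≡ sumℚ g
  sumℚ-cong {zero}  f≗g = refl
  sumℚ-cong {suc n} f≗g = cong₂ _+_ (f≗g zero) (sumℚ-cong (λ i → f≗g (suc i)))

  sumℚ-*-distribʳ : ∀ {n} (f : Fin n → ℚ) c → sumℚ f * c ≡ sumℚ (λ i → f i * c)
  sumℚ-*-distribʳ {zero}  f c = *-zeroˡ c
  sumℚ-*-distribʳ {suc n} f c =
    trans (*-distribʳ-+ c (f zero) _) (cong (_+_ (f zero * c)) (sumℚ-*-distribʳ (λ i → f (suc i)) c))

  ℕ→ℚ-sum : ∀ {n} (g : Fin n → ℕ) → ℕ→ℚ (sum g) ≡ sumℚ (λ i → ℕ→ℚ (g i))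
  ℕ→ℚ-sum {zero}  g = refl
  ℕ→ℚ-sum {suc n} g =
    trans (ℕ→ℚ-homo-+ (g zero) _) (cong (_+_ (ℕ→ℚ (g zero))) (ℕ→ℚ-sum (λ i → g (suc i))))

module WalkCounting where

  open import Defs hiding (sym)
  open import Data.Nat using (ℕ; zero; suc; _+_; _*_; _^_; _≤_; _<_; z≤n; s≤s)
  open import Data.Nat.Properties
  open import Data.Bool using (true; false; not)
  open import Data.Fin using (Fin; zero; suc)
  open import Data.Fin.Subset using (Subset; _∉_) renaming (∣_∣ to card)
  open import Data.Vec using ([]; _∷_; lookup)
  open import Data.Vec.Properties using ([]=⇒lookup)
  open import Data.Product using (Σ; _×_; _,_)
  open import Data.Empty using (⊥-elim)
  open import Algebra.Properties.Semiring.Sum +-*-semiring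
  open import Relation.Binary.PropositionalEquality

  sumℕ≡sum : ∀ {n} (f : Fin n → ℕ) → sumℕ f ≡ sum f
  sumℕ≡sum {zero}  f = refl
  sumℕ≡sum {suc n} f = cong (f zero +_) (sumℕ≡sum (λ i → f (suc i)))

  sum-mono-≤ : ∀ {n} {f g : Fin n → ℕ} → (∀ i → f i ≤ g i) → sum f ≤ sum g
  sum-mono-≤ {zero}  f≤g = z≤n
  sum-mono-≤ {suc n} f≤g = +-mono-≤ (f≤g zero) (sum-mono-≤ (λ i → f≤g (suc i)))

  sum-pos⇒pos : ∀ {n} (f : Fin n → ℕ) → 0 < sum f → Σ (Fin n) λ i → 0 < f i
  sum-pos⇒pos {suc n} f pos with f zero in eq
  ... | suc _ = zero , subst (0 <_) (sym eq) (s≤s z≤n)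
  ... | zero with sum-pos⇒pos (λ i → f (suc i)) pos
  ...   | i , fi>0 = suc i , fi>0

  *-pos⇒pos : ∀ m n → 0 < m * n → 0 < m × 0 < n
  *-pos⇒pos (suc m) (suc n) _ = s≤s z≤n , s≤s z≤n
  *-pos⇒pos (suc m) zero mn>0 = ⊥-elim (<-irrefl refl (subst (0 <_) (*-zeroʳ m) mn>0))

  b2ℕ-*-≤ : ∀ b x → b2ℕ b * x ≤ x
  b2ℕ-*-≤ true  x = ≤-reflexive (+-identityʳ x)
  b2ℕ-*-≤ false x = z≤n

  ≤-b2ℕ-* : ∀ b {x y} → (0 < x → b ≡ true) → x ≤ y → x ≤ b2ℕ b * y
  ≤-b2ℕ-* b {zero}      _      _   = z≤n
  ≤-b2ℕ-* b {suc x} {y} x>0⇒b x≤y rewrite x>0⇒b (s≤s z≤n) = subst (suc x ≤_) (sym (+-identityʳ y)) x≤y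

  b2ℕ-not-*-pos : ∀ b x → 0 < b2ℕ (not b) * x → b ≡ false × 0 < x
  b2ℕ-not-*-pos false x pos = refl , subst (0 <_) (+-identityʳ x) pos

  b2ℕ-pos : ∀ {b} → 0 < b2ℕ b → b ≡ true
  b2ℕ-pos {true} _ = refl

  lookup-false⇒∉ : ∀ {n} (S : Subset n) {u} → lookup S u ≡ false → u ∉ S
  lookup-false⇒∉ S Su≡false u∈S with trans (sym ([]=⇒lookup u∈S)) Su≡false
  ... | ()

  card≡sum : ∀ {n} (S : Subset n) → card S ≡ ∑[ u < n ] b2ℕ (lookup S u)
  card≡sum []          = refl
  card≡sum (true ∷ S)  = cong suc (card≡sum S)
  card≡sum (false ∷ S) = card≡sum S

  sum-split : ∀ {n} (S : Subset n) (g : Fin n → ℕ) →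
              ∑[ u < n ] (b2ℕ (not (lookup S u)) * g u) + ∑[ u < n ] (b2ℕ (lookup S u) * g u) ≡ sum g
  sum-split S g =
    trans (sym (∑-distrib-+ (λ u → b2ℕ (not (lookup S u)) * g u) (λ u → b2ℕ (lookup S u) * g u)))
          (sum-cong-≗ (λ u → split (lookup S u) (g u)))
    where
    split : ∀ b x → b2ℕ (not b) * x + b2ℕ b * x ≡ x
    split true  x = +-identityʳ x
    split false x = trans (+-identityʳ (x + 0)) (+-identityʳ x)

  point : ∀ {n} → Fin n → Fin n → ℕ
  point zero    zero    = 1
  point zero    (suc _) = 0
  point (suc _) zero    = 0
  point (suc v) (suc u) = point v u

  point-sym : ∀ {n} (v u : Fin n) → point v u ≡ point u v
  point-sym zero    zero    = refl
  point-sym zero    (suc u) = refl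
  point-sym (suc v) zero    = refl
  point-sym (suc v) (suc u) = point-sym v u

  point-pos⇒≡ : ∀ {n} (v u : Fin n) → 0 < point v u → v ≡ u
  point-pos⇒≡ zero    zero    _   = refl
  point-pos⇒≡ (suc v) (suc u) pos = cong suc (point-pos⇒≡ v u pos)

  ∑-point : ∀ {n} (v : Fin n) (g : Fin n → ℕ) → ∑[ u < n ] (point v u * g u) ≡ g v
  ∑-point {suc n} zero g =
    trans (cong₂ _+_ (+-identityʳ (g zero)) (sum-replicate-zero n)) (+-identityʳ (g zero))
  ∑-point {suc n} (suc v) g = ∑-point v (λ u → g (suc u))

  ∑-point-1 : ∀ {n} (v : Fin n) → ∑[ u < n ] point v u ≡ 1
  ∑-point-1 v = trans (sum-cong-≗ (λ u → sym (*-identityʳ (point v u)))) (∑-point v (λ _ → 1))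

  module _ {n : ℕ} (G : Graph n) where

    edge : Fin n → Fin n → ℕ
    edge w u = b2ℕ (adj G w u)

    walks : ℕ → Fin n → Fin n → ℕ
    walks zero    v u = point v u
    walks (suc t) v u = ∑[ w < n ] (walks t v w * edge w u)

  module _ {n D : ℕ} (G : Graph n) (regular : Regular D G) where

    ∑-edge-out : ∀ w → ∑[ u < n ] edge G w u ≡ D
    ∑-edge-out w = trans (sym (sumℕ≡sum (edge G w))) (regular w)

    ∑-edge-in : ∀ u → ∑[ w < n ] edge G w u ≡ D
    ∑-edge-in u = trans (sum-cong-≗ (λ w → cong b2ℕ (Graph.sym G w u))) (∑-edge-out u)

    ∑-walks-into : ∀ t u → ∑[ v < n ] walks G t v u ≡ D ^ t
    ∑-walks-into zero    u = trans (sum-cong-≗ (λ v → point-sym v u)) (∑-point-1 u)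
    ∑-walks-into (suc t) u = begin
      ∑[ v < n ] ∑[ w < n ] (walks G t v w * edge G w u)
        ≡⟨ ∑-comm (λ v w → walks G t v w * edge G w u) ⟩
      ∑[ w < n ] ∑[ v < n ] (walks G t v w * edge G w u)
        ≡⟨ sum-cong-≗ (λ w → *-distribʳ-sum (edge G w u) (λ v → walks G t v w)) ⟨
      ∑[ w < n ] ((∑[ v < n ] walks G t v w) * edge G w u)
        ≡⟨ sum-cong-≗ (λ w → cong (_* edge G w u) (∑-walks-into t w)) ⟩
      ∑[ w < n ] (D ^ t * edge G w u)   ≡⟨ *-distribˡ-sum (D ^ t) (λ w → edge G w u) ⟨
      D ^ t * ∑[ w < n ] edge G w u     ≡⟨ cong (D ^ t *_) (∑-edge-in u) ⟩
      D ^ t * D                         ≡⟨ *-comm (D ^ t) D ⟩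
      D ^ suc t                         ∎
      where open ≡-Reasoning

  module Avoidance {n D : ℕ} (G : Graph n) (regular : Regular D G) (S : Subset n) where

    outside inside : Fin n → ℕ
    outside u = b2ℕ (not (lookup S u))
    inside  u = b2ℕ (lookup S u)

    avoiding : ℕ → Fin n → Fin n → ℕ
    avoiding zero    v u = outside u * point v u
    avoiding (suc t) v u = outside u * ∑[ w < n ] (avoiding t v w * edge G w u)

    avoidingFrom : ℕ → Fin n → ℕ
    avoidingFrom t v = ∑[ u < n ] avoiding t v u

    endingInside : ℕ → Fin n → ℕ
    endingInside t v = ∑[ u < n ] (inside u * walks G t v u)

    -- visits t v counts pairs (w , s) of a walk w of length t from v and a time s ≤ t with w s ∈ S.
    visits : ℕ → Fin n → ℕ
    visits zero    v = endingInside zero v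
    visits (suc t) v = D * visits t v + endingInside (suc t) v

    avoiding≤walks : ∀ t v u → avoiding t v u ≤ walks G t v u
    avoiding≤walks zero    v u = b2ℕ-*-≤ (not (lookup S u)) (point v u)
    avoiding≤walks (suc t) v u = ≤-trans (b2ℕ-*-≤ (not (lookup S u)) _)
      (sum-mono-≤ (λ w → *-monoˡ-≤ (edge G w u) (avoiding≤walks t v w)))

    module _ (f : Fin n → ℕ) (sep : ∀ u v → u ∉ S → v ∉ S → adj G u v ≡ true → f u ≡ f v) where

      avoiding-pos⇒samePart : ∀ t v u → 0 < avoiding t v u → lookup S u ≡ false × f u ≡ f v
      avoiding-pos⇒samePart zero v u pos with b2ℕ-not-*-pos (lookup S u) (point v u) pos
      ... | u∉S , vu>0 = u∉S , cong f (sym (point-pos⇒≡ v u vu>0))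
      avoiding-pos⇒samePart (suc t) v u pos with b2ℕ-not-*-pos (lookup S u) _ pos
      ... | u∉S , sum>0 with sum-pos⇒pos (λ w → avoiding t v w * edge G w u) sum>0
      ...   | w , term>0 with *-pos⇒pos (avoiding t v w) (edge G w u) term>0
      ...     | vw>0 , wu>0 with avoiding-pos⇒samePart t v w vw>0
      ...       | w∉S , fw≡fv =
        u∉S , trans (sym (sep w u (lookup-false⇒∉ S w∉S) (lookup-false⇒∉ S u∉S) (b2ℕ-pos wu>0))) fw≡fv

    avoidingFrom-step : ∀ t v → D * avoidingFrom t v ≤ avoidingFrom (suc t) v + endingInside (suc t) v
    avoidingFrom-step t v = begin
      D * avoidingFrom t v              ≡⟨ *-comm D _ ⟩
      avoidingFrom t v * D              ≡⟨ *-distribʳ-sum D (avoiding t v) ⟩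
      ∑[ w < n ] (avoiding t v w * D)
        ≡⟨ sum-cong-≗ (λ w → cong (avoiding t v w *_) (∑-edge-out G regular w)) ⟨
      ∑[ w < n ] (avoiding t v w * ∑[ u < n ] edge G w u)
        ≡⟨ sum-cong-≗ (λ w → *-distribˡ-sum (avoiding t v w) (edge G w)) ⟩
      ∑[ w < n ] ∑[ u < n ] (avoiding t v w * edge G w u)
        ≡⟨ ∑-comm (λ w u → avoiding t v w * edge G w u) ⟩
      sum next                          ≡⟨ sum-split S next ⟨
      avoidingFrom (suc t) v + ∑[ u < n ] (inside u * next u)
        ≤⟨ +-monoʳ-≤ (avoidingFrom (suc t) v)
             (sum-mono-≤ (λ u → *-monoʳ-≤ (inside u) (next≤walks u))) ⟩
      avoidingFrom (suc t) v + endingInside (suc t) v ∎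
      where
      open ≤-Reasoning
      next : Fin n → ℕ
      next u = ∑[ w < n ] (avoiding t v w * edge G w u)
      next≤walks : ∀ u → next u ≤ walks G (suc t) v u
      next≤walks u = sum-mono-≤ (λ w → *-monoˡ-≤ (edge G w u) (avoiding≤walks t v w))

    walk-avoids-or-visits : ∀ t v → D ^ t ≤ avoidingFrom t v + visits t v
    walk-avoids-or-visits zero    v = ≤-reflexive (sym (trans (sum-split S (point v)) (∑-point-1 v)))
    walk-avoids-or-visits (suc t) v = begin
      D * D ^ t                               ≤⟨ *-monoʳ-≤ D (walk-avoids-or-visits t v) ⟩
      D * (avoidingFrom t v + visits t v)     ≡⟨ *-distribˡ-+ D _ _ ⟩
      D * avoidingFrom t v + D * visits t v   ≤⟨ +-monoˡ-≤ _ (avoidingFrom-step t v) ⟩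
      avoidingFrom (suc t) v + endingInside (suc t) v + D * visits t v
        ≡⟨ +-assoc (avoidingFrom (suc t) v) _ _ ⟩
      avoidingFrom (suc t) v + (endingInside (suc t) v + D * visits t v)
        ≡⟨ cong (avoidingFrom (suc t) v +_) (+-comm (endingInside (suc t) v) _) ⟩
      avoidingFrom (suc t) v + visits (suc t) v ∎
      where open ≤-Reasoning

    ∑-endingInside : ∀ t → ∑[ v < n ] endingInside t v ≡ card S * D ^ t
    ∑-endingInside t = begin
      ∑[ v < n ] ∑[ u < n ] (inside u * walks G t v u)
        ≡⟨ ∑-comm (λ v u → inside u * walks G t v u) ⟩
      ∑[ u < n ] ∑[ v < n ] (inside u * walks G t v u)
        ≡⟨ sum-cong-≗ (λ u → *-distribˡ-sum (inside u) (λ v → walks G t v u)) ⟨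
      ∑[ u < n ] (inside u * ∑[ v < n ] walks G t v u)
        ≡⟨ sum-cong-≗ (λ u → cong (inside u *_) (∑-walks-into G regular t u)) ⟩
      ∑[ u < n ] (inside u * D ^ t)                     ≡⟨ *-distribʳ-sum (D ^ t) inside ⟨
      sum inside * D ^ t                                ≡⟨ cong (_* D ^ t) (card≡sum S) ⟨
      card S * D ^ t                                    ∎
      where open ≡-Reasoning

    ∑-visits : ∀ t → ∑[ v < n ] visits t v ≡ suc t * (card S * D ^ t)
    ∑-visits zero    = trans (∑-endingInside zero) (sym (+-identityʳ _))
    ∑-visits (suc t) = begin
      ∑[ v < n ] (D * visits t v + endingInside (suc t) v)
        ≡⟨ ∑-distrib-+ (λ v → D * visits t v) (endingInside (suc t)) ⟩
      ∑[ v < n ] (D * visits t v) + ∑[ v < n ] endingInside (suc t) v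
        ≡⟨ cong₂ _+_ (sym (*-distribˡ-sum D (visits t))) (∑-endingInside (suc t)) ⟩
      D * ∑[ v < n ] visits t v + card S * D ^ suc t
        ≡⟨ cong (λ x → D * x + card S * D ^ suc t) (∑-visits t) ⟩
      D * (suc t * (card S * D ^ t)) + card S * (D * D ^ t)
        ≡⟨ solve 4 (λ d t s p → d :* (t :* (s :* p)) :+ s :* (d :* p) := (con 1 :+ t) :* (s :* (d :* p)))
                 refl D (suc t) (card S) (D ^ t) ⟩
      suc (suc t) * (card S * D ^ suc t) ∎
      where
      open ≡-Reasoning
      open import Data.Nat.Solver using (module +-*-Solver)
      open +-*-Solver

module Distributions where

  open import Defs hiding (sym)
  open ℕ→ℚ-Properties
  open WalkCounting using (point; edge; walks)
  open import Data.Nat as ℕ using (ℕ; zero; suc; NonZero)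
  import Data.Nat.Properties as ℕₚ
  open import Data.Bool using (true; false; if_then_else_)
  open import Data.Fin using (Fin; zero; suc)
  open import Data.Fin.Subset using (Subset) renaming (∣_∣ to card)
  open import Data.Vec using (lookup)
  open import Data.Integer using (+_)
  open import Data.Rational using (ℚ; 0ℚ; 1ℚ; _+_; _*_; _-_; _/_; ∣_∣; _≤_; _<_; Positive)
  open import Data.Rational.Properties
  open import Algebra.Bundles using (CommutativeMonoid)
  open import Algebra.Properties.CommutativeSemigroup (CommutativeMonoid.commutativeSemigroup *-1-commutativeMonoid)
    using (interchange)
  open import Algebra.Properties.Semiring.Sum ℕₚ.+-*-semiring using (sum-syntax)
  open import Relation.Binary.PropositionalEquality

  δpt≡point : ∀ {n} (v u : Fin n) → δpt v u ≡ ℕ→ℚ (point v u)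
  δpt≡point zero    zero    = refl
  δpt≡point zero    (suc u) = refl
  δpt≡point (suc v) zero    = refl
  δpt≡point (suc v) (suc u) = δpt≡point v u

  if-else-0-scaled : ∀ b x K m → x * ℕ→ℚ K ≡ ℕ→ℚ m → (if b then x else 0ℚ) * ℕ→ℚ K ≡ ℕ→ℚ (b2ℕ b ℕ.* m)
  if-else-0-scaled true  x K m x*K≡m = trans x*K≡m (cong ℕ→ℚ (sym (ℕₚ.+-identityʳ m)))
  if-else-0-scaled false x K m _     = *-zeroˡ (ℕ→ℚ K)

  Q*D^t≡walks : ∀ {n} (G : Graph n) D .{{_ : NonZero D}} t v u →
                Q G D t v u * ℕ→ℚ (D ℕ.^ t) ≡ ℕ→ℚ (walks G t v u)
  Q*D^t≡walks G D zero    v u = trans (*-identityʳ (δpt v u)) (δpt≡point v u)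
  Q*D^t≡walks G D (suc t) v u = begin
    sumℚ (λ w → Q G D t v w * step w) * ℕ→ℚ (D ℕ.^ suc t)
      ≡⟨ sumℚ-*-distribʳ (λ w → Q G D t v w * step w) _ ⟩
    sumℚ (λ w → Q G D t v w * step w * ℕ→ℚ (D ℕ.^ suc t))
      ≡⟨ sumℚ-cong term ⟩
    sumℚ (λ w → ℕ→ℚ (walks G t v w ℕ.* edge G w u))
      ≡⟨ ℕ→ℚ-sum (λ w → walks G t v w ℕ.* edge G w u) ⟨
    ℕ→ℚ (walks G (suc t) v u) ∎
    where
    open ≡-Reasoning
    step : Fin _ → ℚ
    step w = if adj G w u then recip D else 0ℚ
    step*D≡edge : ∀ w → step w * ℕ→ℚ D ≡ ℕ→ℚ (edge G w u)
    step*D≡edge w = trans (if-else-0-scaled (adj G w u) (recip D) D 1 (recip-inverseˡ D))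
                          (cong ℕ→ℚ (ℕₚ.*-identityʳ (edge G w u)))
    D^[1+t]≡D^t*D : ℕ→ℚ (D ℕ.^ suc t) ≡ ℕ→ℚ (D ℕ.^ t) * ℕ→ℚ D
    D^[1+t]≡D^t*D = trans (cong ℕ→ℚ (ℕₚ.*-comm D (D ℕ.^ t))) (ℕ→ℚ-homo-* (D ℕ.^ t) D)
    term : ∀ w → Q G D t v w * step w * ℕ→ℚ (D ℕ.^ suc t) ≡ ℕ→ℚ (walks G t v w ℕ.* edge G w u)
    term w = begin
      Q G D t v w * step w * ℕ→ℚ (D ℕ.^ suc t)
        ≡⟨ cong (Q G D t v w * step w *_) D^[1+t]≡D^t*D ⟩
      Q G D t v w * step w * (ℕ→ℚ (D ℕ.^ t) * ℕ→ℚ D)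
        ≡⟨ interchange (Q G D t v w) (step w) (ℕ→ℚ (D ℕ.^ t)) (ℕ→ℚ D) ⟩
      Q G D t v w * ℕ→ℚ (D ℕ.^ t) * (step w * ℕ→ℚ D)
        ≡⟨ cong₂ _*_ (Q*D^t≡walks G D t v w) (step*D≡edge w) ⟩
      ℕ→ℚ (walks G t v w) * ℕ→ℚ (edge G w u)
        ≡⟨ ℕ→ℚ-homo-* (walks G t v w) (edge G w u) ⟨
      ℕ→ℚ (walks G t v w ℕ.* edge G w u) ∎

  prob*D^t≡walksInto : ∀ {n} (G : Graph n) D .{{_ : NonZero D}} t v (A : Subset n) →
    prob (Q G D t v) A * ℕ→ℚ (D ℕ.^ t) ≡ ℕ→ℚ (∑[ u < n ] (b2ℕ (lookup A u) ℕ.* walks G t v u))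
  prob*D^t≡walksInto G D t v A =
    trans (sumℚ-*-distribʳ (λ u → if lookup A u then Q G D t v u else 0ℚ) _)
      (trans (sumℚ-cong (λ u → if-else-0-scaled (lookup A u) _ (D ℕ.^ t) (walks G t v u)
                                  (Q*D^t≡walks G D t v u)))
        (sym (ℕ→ℚ-sum (λ u → b2ℕ (lookup A u) ℕ.* walks G t v u))))

  uniform*n≡card : ∀ {n} .{{_ : NonZero n}} (A : Subset n) → uniform A * ℕ→ℚ n ≡ ℕ→ℚ (card A)
  uniform*n≡card {n} A =
    trans (*-assoc (ℕ→ℚ (card A)) _ _)
          (trans (cong (ℕ→ℚ (card A) *_) (recip-inverseˡ n)) (*-identityʳ _))

  module _ (x : ℚ) (K M : ℕ) .{{_ : NonZero K}} (x*K≡M : x * ℕ→ℚ K ≡ ℕ→ℚ M) where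

    private
      instance
        K-positive : Positive (ℕ→ℚ K)
        K-positive = ℕ→ℚ-positive K

      scaled : ∀ b → ℕ→ℚ b * x * ℕ→ℚ K ≡ ℕ→ℚ (b ℕ.* M)
      scaled b = trans (*-assoc (ℕ→ℚ b) x (ℕ→ℚ K)) (trans (cong (ℕ→ℚ b *_) x*K≡M) (sym (ℕ→ℚ-homo-* b M)))

    ≤-scaled : ∀ a b → a ℕ.* K ℕ.≤ b ℕ.* M → ℕ→ℚ a ≤ ℕ→ℚ b * x
    ≤-scaled a b aK≤bM = *-cancelʳ-≤-pos (ℕ→ℚ K)
      (subst₂ _≤_ (ℕ→ℚ-homo-* a K) (sym (scaled b)) (ℕ→ℚ-mono-≤ aK≤bM))

    scaled-≤ : ∀ a b → b ℕ.* M ℕ.≤ a ℕ.* K → ℕ→ℚ b * x ≤ ℕ→ℚ a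
    scaled-≤ a b bM≤aK = *-cancelʳ-≤-pos (ℕ→ℚ K)
      (subst₂ _≤_ (sym (scaled b)) (ℕ→ℚ-homo-* a K) (ℕ→ℚ-mono-≤ bM≤aK))

  far-apart : ∀ {p u} → ℕ→ℚ 23 ≤ ℕ→ℚ 24 * p → ℕ→ℚ 3 * u ≤ ℕ→ℚ 2 → + 1 / 30 ≤ ∣ p - u ∣
  far-apart {p} {u} 23≤24p 3u≤2 = begin
    + 1 / 30             ≤⟨ ≤ᵇ⇒≤ _ ⟩
    + 23 / 24 - + 2 / 3  ≤⟨ gap ⟩
    p - u                ≡⟨ 0≤p⇒∣p∣≡p (≤-trans (≤ᵇ⇒≤ _) gap) ⟨
    ∣ p - u ∣            ∎
    where
    open ≤-Reasoning
    -- Closed rationals normalise, so ℕ→ℚ 24 * (+ 23 / 24) is ℕ→ℚ 23 by computation.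
    gap : + 23 / 24 - + 2 / 3 ≤ p - u
    gap = +-mono-≤ (*-cancelˡ-≤-pos {+ 23 / 24} {p} (ℕ→ℚ 24) {{ℕ→ℚ-positive 24}} 23≤24p)
                   (neg-antimono-≤ (*-cancelˡ-≤-pos {u} {+ 2 / 3} (ℕ→ℚ 3) {{ℕ→ℚ-positive 3}} 3u≤2))

  below-fraction : ∀ {s b} k .{{_ : NonZero k}} {x : ℚ} → ℕ→ℚ s < x * recip k → x ≤ ℕ→ℚ b → s ℕ.* k ℕ.< b
  below-fraction {s} {b} k {x} s<x/k x≤b = ℕ→ℚ-cancel-< (begin-strict
    ℕ→ℚ (s ℕ.* k)           ≡⟨ ℕ→ℚ-homo-* s k ⟩
    ℕ→ℚ s * ℕ→ℚ k           <⟨ *-monoˡ-<-pos (ℕ→ℚ k) {{ℕ→ℚ-positive k}} s<x/k ⟩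
    x * recip k * ℕ→ℚ k     ≡⟨ *-assoc x (recip k) (ℕ→ℚ k) ⟩
    x * (recip k * ℕ→ℚ k)   ≡⟨ cong (x *_) (recip-inverseˡ k) ⟩
    x * 1ℚ                  ≡⟨ *-identityʳ x ⟩
    x                       ≤⟨ x≤b ⟩
    ℕ→ℚ b                   ∎)
    where open ≤-Reasoning

module Separators where

  open import Defs hiding (sym)
  open WalkCounting
  open Distributions
  open import Data.Nat using (ℕ; suc; _+_; _*_; _^_; _≤_; _<_; _≤?_; _≡ᵇ_; z≤n; NonZero)
  open import Data.Nat.Properties
  open import Data.Bool using (true; false; not; _∧_; if_then_else_)
  open import Data.Bool.Properties using (T-≡)
  open import Data.Fin using (Fin)
  open import Data.Fin.Properties using (nonZeroIndex)
  open import Data.Fin.Subset using (Subset; _∈_; _∉_) renaming (∣_∣ to card)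
  open import Data.Vec using (lookup; tabulate)
  open import Data.Vec.Properties using (lookup∘tabulate; lookup⇒[]=)
  open import Data.Integer using (+_)
  open import Data.Rational as ℚ using (ℚ; _/_)
  import Data.Rational.Properties as ℚ
  open import Data.Product using (_,_)
  open import Data.Empty using (⊥-elim)
  open import Function using (Equivalence)
  open import Algebra.Properties.Semiring.Sum +-*-semiring
  open import Relation.Binary.PropositionalEquality
  open import Relation.Nullary using (¬_; yes; no)

  part : ∀ {n} → Subset n → (Fin n → ℕ) → ℕ → Subset n
  part S f k = tabulate (λ u → not (lookup S u) ∧ (f u ≡ᵇ k))

  card-part : ∀ {n} (S : Subset n) f k → card (part S f k) ≡ partSize S f k
  card-part {n} S f k = begin
    card (part S f k)                         ≡⟨ card≡sum (part S f k) ⟩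
    ∑[ u < n ] b2ℕ (lookup (part S f k) u)
      ≡⟨ sum-cong-≗ (λ u → cong b2ℕ (lookup∘tabulate (λ u → not (lookup S u) ∧ (f u ≡ᵇ k)) u)) ⟩
    ∑[ u < n ] b2ℕ (not (lookup S u) ∧ (f u ≡ᵇ k))
      ≡⟨ sum-cong-≗ (λ u → indicator (lookup S u) (f u ≡ᵇ k)) ⟩
    ∑[ u < n ] (if lookup S u then 0 else (if f u ≡ᵇ k then 1 else 0))
      ≡⟨ sumℕ≡sum (λ u → if lookup S u then 0 else (if f u ≡ᵇ k then 1 else 0)) ⟨
    partSize S f k                            ∎
    where
    open ≡-Reasoning
    indicator : ∀ b c → b2ℕ (not b ∧ c) ≡ (if b then 0 else (if c then 1 else 0))
    indicator true  c     = refl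
    indicator false true  = refl
    indicator false false = refl

  lookup-part : ∀ {n} (S : Subset n) f {k u} → lookup S u ≡ false → f u ≡ k → lookup (part S f k) u ≡ true
  lookup-part S f {k} {u} u∉S fu≡k rewrite lookup∘tabulate (λ u → not (lookup S u) ∧ (f u ≡ᵇ k)) u | u∉S =
    Equivalence.to T-≡ (≡⇒≡ᵇ (f u) k fu≡k)

  module _ {n D : ℕ} .{{_ : NonZero D}} (G : Graph n) (regular : Regular D G)
           (S : Subset n) (f : Fin n → ℕ)
           (sep : ∀ u v → u ∉ S → v ∉ S → adj G u v ≡ true → f u ≡ f v)
           (small-parts : ∀ k → 3 * partSize S f k ≤ 2 * n)
           {δ : ℚ} (δ≤1/30 : δ ℚ.≤ + 1 / 30) (τ : ℕ) where

    open Avoidance G regular S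

    private
      instance
        D^τ≢0 : NonZero (D ^ τ)
        D^τ≢0 = m^n≢0 D τ

    mostly-avoiding⇒far : ∀ v → 23 * D ^ τ < 24 * avoidingFrom τ v → ¬ TVToUniformLess (Q G D τ v) δ
    mostly-avoiding⇒far v most close =
      ℚ.<-irrefl refl (ℚ.<-≤-trans (close P) (ℚ.≤-trans δ≤1/30
        (far-apart {prob (Q G D τ v) P} {uniform P} concentrated sparse)))
      where
      instance
        n≢0 : NonZero n
        n≢0 = nonZeroIndex v
      P = part S f (f v)
      walksIntoP : ℕ
      walksIntoP = ∑[ u < n ] (b2ℕ (lookup P u) * walks G τ v u)
      avoiding≤walksIntoP : avoidingFrom τ v ≤ walksIntoP
      avoiding≤walksIntoP = sum-mono-≤ λ u → ≤-b2ℕ-* (lookup P u)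
        (λ pos → let u∉S , fu≡fv = avoiding-pos⇒samePart f sep τ v u pos in lookup-part S f u∉S fu≡fv)
        (avoiding≤walks τ v u)
      concentrated : ℕ→ℚ 23 ℚ.≤ ℕ→ℚ 24 ℚ.* prob (Q G D τ v) P
      concentrated = ≤-scaled (prob (Q G D τ v) P) (D ^ τ) walksIntoP
        (prob*D^t≡walksInto G D τ v P) 23 24
        (<⇒≤ (<-≤-trans most (*-monoʳ-≤ 24 avoiding≤walksIntoP)))
      sparse : ℕ→ℚ 3 ℚ.* uniform P ℚ.≤ ℕ→ℚ 2
      sparse = scaled-≤ (uniform P) n (card P) (uniform*n≡card P) 2 3
        (subst (λ c → 3 * c ≤ 2 * n) (sym (card-part S f (f v))) (small-parts (f v)))

    mixing⇒visits : ∀ v → TVToUniformLess (Q G D τ v) δ → D ^ τ ≤ 24 * visits τ v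
    mixing⇒visits v close with 24 * avoidingFrom τ v ≤? 23 * D ^ τ
    ... | no  most = ⊥-elim (mostly-avoiding⇒far v (≰⇒> most) close)
    ... | yes few  = +-cancelˡ-≤ (23 * D ^ τ) (D ^ τ) (24 * visits τ v) (begin
      23 * D ^ τ + D ^ τ                         ≡⟨ +-comm (23 * D ^ τ) (D ^ τ) ⟩
      24 * D ^ τ                                 ≤⟨ *-monoʳ-≤ 24 (walk-avoids-or-visits τ v) ⟩
      24 * (avoidingFrom τ v + visits τ v)       ≡⟨ *-distribˡ-+ 24 (avoidingFrom τ v) (visits τ v) ⟩
      24 * avoidingFrom τ v + 24 * visits τ v    ≤⟨ +-monoˡ-≤ (24 * visits τ v) few ⟩
      23 * D ^ τ + 24 * visits τ v               ∎)
      where open ≤-Reasoning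

    mixing-set-bound : (B : Subset n) → (∀ v → v ∈ B → TVToUniformLess (Q G D τ v) δ) →
                       card B ≤ 24 * suc τ * card S
    mixing-set-bound B mixing = *-cancelʳ-≤ (card B) (24 * suc τ * card S) (D ^ τ) (begin
      card B * D ^ τ                              ≡⟨ cong (_* D ^ τ) (card≡sum B) ⟩
      (∑[ v < n ] b2ℕ (lookup B v)) * D ^ τ       ≡⟨ *-distribʳ-sum (D ^ τ) (λ v → b2ℕ (lookup B v)) ⟩
      ∑[ v < n ] (b2ℕ (lookup B v) * D ^ τ)       ≤⟨ sum-mono-≤ per-vertex ⟩
      ∑[ v < n ] (24 * visits τ v)                ≡⟨ *-distribˡ-sum 24 (visits τ) ⟨
      24 * ∑[ v < n ] visits τ v                  ≡⟨ cong (24 *_) (∑-visits τ) ⟩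
      24 * (suc τ * (card S * D ^ τ))             ≡⟨ *-assoc 24 (suc τ) _ ⟨
      24 * suc τ * (card S * D ^ τ)               ≡⟨ *-assoc (24 * suc τ) (card S) (D ^ τ) ⟨
      24 * suc τ * card S * D ^ τ                 ∎)
      where
      open ≤-Reasoning
      per-vertex : ∀ v → b2ℕ (lookup B v) * D ^ τ ≤ 24 * visits τ v
      per-vertex v with lookup B v in v∈B
      ... | false = z≤n
      ... | true  = subst (_≤ 24 * visits τ v) (sym (+-identityʳ (D ^ τ)))
                      (mixing⇒visits v (mixing v (lookup⇒[]= v B v∈B)))

  24[1+τ]s≤s[48τ] : ∀ τ .{{_ : NonZero τ}} s → 24 * suc τ * s ≤ s * (48 * τ)
  24[1+τ]s≤s[48τ] (suc t) s = subst (24 * suc (suc t) * s ≤_) (sym s*48[1+t]) (m≤m+n _ _)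
    where
    open import Data.Nat.Solver using (module +-*-Solver)
    open +-*-Solver
    s*48[1+t] : s * (48 * suc t) ≡ 24 * suc (suc t) * s + 24 * t * s
    s*48[1+t] = solve 2 (λ s t → s :* (con 48 :* (con 1 :+ t)) := con 24 :* (con 2 :+ t) :* s :+ con 24 :* t :* s)
                  refl s t

open import Defs
open import Data.Nat using (ℕ; _≤_; NonZero; >-nonZero)
open import Data.Nat.Properties using (<⇒≱; ≤-trans; m*n≢0)
open import Data.Integer using (+_)
open import Data.Rational using (ℚ; 0ℚ; _<_; _*_; _/_) renaming (_≤_ to _≤ℚ_)
open import Data.Fin.Subset using (Subset; _∈_) renaming (∣_∣ to card)
open import Data.Product using (Σ; _×_; _,_)
open import Relation.Nullary using (¬_)
open Distributions using (below-fraction)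
open Separators using (mixing-set-bound; 24[1+τ]s≤s[48τ])

corollary1p2 :
    (ε δ : ℚ) → 0ℚ < ε → ε < + 2 / 5 → 0ℚ < δ → δ ≤ℚ + 1 / 30 →
    (τ : ℕ) → 1 ≤ τ →
    (D : ℕ) → 1 ≤ D →
    (n : ℕ) → (G : Graph n) → Regular D G →
    (Σ (Subset n) λ B → (ε * ℕ→ℚ n ≤ℚ ℕ→ℚ (card B))
                      × ((v : _) → v ∈ B → TVToUniformLess (Q G D τ v) δ)) →
    ¬ (Σ (Subset n) λ S → IsSeparator G S
                        × (ℕ→ℚ (card S) < ε * ℕ→ℚ n * recip (48 Data.Nat.* τ)))
corollary1p2 _ _ _ _ _ δ≤1/30 τ 1≤τ D 1≤D _ G regular (B , εn≤|B| , mixing)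
             (S , (f , sep , small-parts) , |S|<εn/48τ) =
  <⇒≱ (below-fraction {card S} {card B} (48 Data.Nat.* τ) |S|<εn/48τ εn≤|B|)
      (≤-trans (mixing-set-bound G regular S f sep small-parts δ≤1/30 τ B mixing)
               (24[1+τ]s≤s[48τ] τ (card S)))
  where
  instance
    τ≢0 : NonZero τ
    τ≢0 = >-nonZero 1≤τ
    D≢0 : NonZero D
    D≢0 = >-nonZero 1≤D
    48τ≢0 : NonZero (48 Data.Nat.* τ)
    48τ≢0 = m*n≢0 48 τ
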